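{- Let $\alpha>2$ be a real number that is not an integer. Consider a Nash equilibrium of the network creation game with parameter $\alpha$ on $n$ vertices, and let $G$ be the resulting network. Fix any vertex $v$, and let $N_i$ be the set of vertices at distance exactly $i$ from $v$. Then \[ |N_1|+|N_2|+1\geq \frac{n}{\alpha}. \]
   Context: The network creation game. There are $n$ agents (vertices) and a parameter $\alpha$. Each agent $v$ chooses a set $S_v$ of other vertices to which it buys edges. The network $G$ is the undirected graph with edges $\{v,w\}$ for $w\in S_v$. Agent $v$'s cost is $\alpha|S_v|+\sum_w \mathrm{dist}_G(v,w)$, with distance $\infty$ between disconnected vertices. A Nash equilibrium is a strategy tuple in which no agent can strictly lower its cost by unilaterally changing its strategy. -}

module Defs where

open import Data.Nat as ℕ using (ℕ; zero; suc; _+_; compare; less; equal; greater)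
open import Data.Integer as ℤ using (ℤ; +_; _-_)
open import Data.Rational as ℚ using (ℚ; _/_)
open import Data.Bool using (Bool; true; false; _∨_; _∧_; if_then_else_)
open import Data.Fin using (Fin; _≟_)
open import Data.Fin.Subset using (Subset; _∉_)
open import Data.Vec using (lookup; _[_]≔_)
open import Data.List using (List; foldr; filter; length)
open import Data.Bool.ListAction using () renaming (any to anyL)
open import Data.Fin.Base using () 
open import Data.List using (allFin)
open import Data.Maybe using (Maybe; just; nothing)
open import Data.Product using (Σ; ∃; _×_)
open import Data.Sum using (_⊎_)
open import Data.Empty using (⊥)
open import Data.Unit using (⊤)
open import Relation.Nullary.Decidable using (⌊_⌋)
open import Relation.Binary.PropositionalEquality using (_≡_)

-- Real numbers as Dedekind cuts of ℚ (the stdlib has no reals).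
-- L q  means  q < α,   U q  means  α < q.

record Real : Set₁ where
  field
    L U         : ℚ → Set
    L-inhabited : ∃ L
    U-inhabited : ∃ U
    L-lower     : ∀ p q → p ℚ.< q → L q → L p
    L-rounded   : ∀ q → L q → ∃ λ r → q ℚ.< r × L r
    U-upper     : ∀ p q → p ℚ.< q → U p → U q
    U-rounded   : ∀ q → U q → ∃ λ r → r ℚ.< q × U r
    disjoint    : ∀ q → L q → U q → ⊥
    located     : ∀ p q → p ℚ.< q → L p ⊎ U q

open Real public

-- α * a + x < α * b + y   (a b x y natural numbers, α real)
LinLt : Real → ℕ → ℕ → ℕ → ℕ → Set
LinLt α a x b y with compare a b
... | less .a k    = L α (((+ x) - (+ y)) / suc k)
... | equal .a     = x ℕ.< y
... | greater .b k = U α (((+ y) - (+ x)) / suc k)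

RealGt2 : Real → Set
RealGt2 α = L α ((+ 2) / 1)

NotInteger : Real → Set
NotInteger α = ∀ (k : ℤ) → (L α (k / 1) ⊎ U α (k / 1))

RealGeQ : Real → ℚ → Set
RealGeQ α q = U α q → ⊥

-- The network creation game on vertex set Fin n.
-- A strategy profile assigns to each agent v the set S v of vertices it
-- buys edges to.

Profile : ℕ → Set
Profile n = Fin n → Subset n

ValidStrategy : ∀ {n} → Fin n → Subset n → Set
ValidStrategy v s = v ∉ s

ValidProfile : ∀ {n} → Profile n → Set
ValidProfile S = ∀ v → ValidStrategy v (S v)

adj : ∀ {n} → Profile n → Fin n → Fin n → Bool
adj S u w = lookup (S u) w ∨ lookup (S w) u

within : ∀ {n} → Profile n → ℕ → Fin n → Fin n → Bool
within S zero    u w = ⌊ u ≟ w ⌋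
within S (suc k) u w = within S k u w ∨ anyL (λ x → adj S u x ∧ within S k x w) (allFin _)

search : ∀ {n} → Profile n → Fin n → Fin n → ℕ → ℕ → Maybe ℕ
search S u w k zero          = if within S k u w then just k else nothing
search S u w k (suc fuel)    = if within S k u w then just k else search S u w (suc k) fuel

-- graph distance; nothing = ∞ (disconnected).  On n vertices any
-- reachable vertex is reached by a walk of length < n, so searching
-- k = 0..n suffices.
dist : ∀ {n} → Profile n → Fin n → Fin n → Maybe ℕ
dist {n} S u w = search S u w 0 n

addM : Maybe ℕ → Maybe ℕ → Maybe ℕ
addM (just a) (just b) = just (a + b)
addM _        _        = nothing

distSum : ∀ {n} → Profile n → Fin n → Maybe ℕ
distSum {n} S v = foldr (λ w acc → addM (dist S v w) acc) (just 0) (allFin n)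

-- cost of agent v: α |S v| + distSum, compared strictly:
-- cost(S') < cost(S) for agent v
CostLt : ∀ {n} → Real → Profile n → Profile n → Fin n → Set
CostLt α S' S v with distSum S' v | distSum S v
... | nothing | _       = ⊥
... | just x  | nothing = ⊤
... | just x  | just y  = LinLt α (Data.Fin.Subset.∣ S' v ∣) x (Data.Fin.Subset.∣ S v ∣) y

deviate : ∀ {n} → Profile n → Fin n → Subset n → Profile n
deviate S v s u = if ⌊ u ≟ v ⌋ then s else S u

NashEq : ∀ {n} → Real → Profile n → Set
NashEq α S = ValidProfile S ×
  (∀ v (s : Subset _) → ValidStrategy v s → CostLt α (deviate S v s) S v → ⊥)

atDist : ∀ {n} → Profile n → Fin n → ℕ → ℕ
atDist {n} S v i = length (filter (λ w → Data.Maybe.Properties.≡-dec ℕ._≟_ (dist S v w) (just i)) (allFin n))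
  where import Data.Maybe.Properties

module Submission where

-- Let N₁, N₂ be the vertices at
-- distance 1 and 2 from v.  Consider the deviation in which v additionally
-- buys an edge to every vertex of N₂.  It costs at most |N₂| new edges,
-- and every vertex at distance d ≥ 2 moves to distance ≤ d − 1, so the
-- distance sum drops from y to some x with n + x ≤ y + 1 + |N₁|.  Since
-- this deviation is not an improvement at equilibrium, either nothing is
-- gained (then n ≤ 1 + |N₁|) or α ≥ (y − x)/c for the number c ≤ |N₂| of
-- new edges; the mediant inequality then gives n/(1 + |N₁| + |N₂|) ≤ α,
-- using α > 2 ≥ 1 for the degenerate cases.

open import Defs
open import Data.Nat using (ℕ; suc; _+_)
open import Data.Integer using (+_)
open import Data.Rational using (_/_)
open import Data.Fin using (Fin)

open import Data.Bool using (Bool; true; false; T)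
open import Data.Bool.Properties using (T-≡; T-∨; T-∧)
open import Data.Empty using (⊥-elim)
open import Data.Fin using (zero; suc; _≟_)
open import Data.Fin.Properties using (toℕ<n)
open import Data.Fin.Subset using (Subset; ∣_∣; _∪_; _∈_; _∉_; _⊆_; ∁; ⁅_⁆)
open import Data.Fin.Subset.Properties
  using (∣p∣≤∣x∷p∣; ∣p∣≤∣p∪q∣; p⊆p∪q; q⊆p∪q; x∈p∪q⁻; x∈∁p⇒x∉p; x∉p⇒x∈∁p; x∈⁅x⁆; x∈⁅y⁆⇒x≡y)
open import Data.Integer as ℤ using (_-_)
import Data.Integer.Properties as ℤP
open import Data.List using (List; filter; length)
import Data.List as List
open import Data.List.Membership.Propositional using (lose)
open import Data.List.Membership.Propositional.Properties using (∈-allFin)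
open import Data.List.Relation.Unary.Any using (satisfied)
open import Data.List.Relation.Unary.Any.Properties using (any⁺; any⁻)
open import Data.Maybe using (Maybe; just; nothing)
import Data.Maybe.Properties as Maybe
open import Data.Nat as ℕ using (zero; _*_; _∸_; _≤_; _<_; z≤n; s≤s; compare; less; equal; greater)
open import Data.Nat.Properties as ℕP using (≤-trans; module ≤-Reasoning)
open import Data.Product using (∃-syntax; _×_; _,_; proj₁; proj₂)
import Data.Rational as ℚ
import Data.Rational.Properties as ℚP
import Data.Rational.Unnormalised as ℚᵘ
import Data.Rational.Unnormalised.Properties as ℚᵘP
open import Data.Sum using (_⊎_; inj₁; inj₂; [_,_]′)
open import Data.Vec using (_∷_; []; lookup)
import Data.Vec as Vec
import Data.Vec.Properties as VecP
open import Function using (id; _∘_; Equivalence; _⇔_; mk⇔)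
open import Relation.Binary.PropositionalEquality
open import Relation.Nullary using (¬_; yes; no; does)
open import Relation.Nullary.Decidable using (fromWitness; toWitness; dec-true; isYes≗does)
open import Relation.Unary using (Decidable)

open import Algebra.Properties.CommutativeMonoid.Sum ℕP.+-0-commutativeMonoid using (sum; ∑-distrib-+)

𝟙 : Bool → ℕ
𝟙 true  = 1
𝟙 false = 0

sum-mono : ∀ {n} {f g : Fin n → ℕ} → (∀ i → f i ≤ g i) → sum f ≤ sum g
sum-mono {zero}  f≤g = z≤n
sum-mono {suc n} f≤g = ℕP.+-mono-≤ (f≤g zero) (sum-mono (f≤g ∘ suc))

sum-ones : ∀ n → sum {n} (λ _ → 1) ≡ n
sum-ones zero    = refl
sum-ones (suc n) = cong suc (sum-ones n)

sum-𝟙-≟ : ∀ {n} (v : Fin n) → sum (λ i → 𝟙 (does (i ≟ v))) ≡ 1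
sum-𝟙-≟ {suc n} zero    = cong suc (sum-zeros n)
  where
  sum-zeros : ∀ m → sum {m} (λ i → 𝟙 (does (suc i ≟ zero))) ≡ 0
  sum-zeros zero    = refl
  sum-zeros (suc m) = sum-zeros m
sum-𝟙-≟ {suc n} (suc v) = sum-𝟙-≟ v

length-filter-sum : ∀ {A : Set} {P : A → Set} (P? : Decidable P) {n} (g : Fin n → A) →
  length (filter P? (List.tabulate g)) ≡ sum (λ i → 𝟙 (does (P? (g i))))
length-filter-sum P? {zero}  g = refl
length-filter-sum P? {suc n} g with does (P? (g zero))
... | true  = cong suc (length-filter-sum P? (g ∘ suc))
... | false = length-filter-sum P? (g ∘ suc)

∣tabulate∣ : ∀ {n} (f : Fin n → Bool) → ∣ Vec.tabulate f ∣ ≡ sum (𝟙 ∘ f)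
∣tabulate∣ {zero}  f = refl
∣tabulate∣ {suc n} f with f zero
... | true  = cong suc (∣tabulate∣ (f ∘ suc))
... | false = ∣tabulate∣ (f ∘ suc)

∣p∪q∣≤∣p∣+∣q∣ : ∀ {n} (p q : Subset n) → ∣ p ∪ q ∣ ≤ ∣ p ∣ + ∣ q ∣
∣p∪q∣≤∣p∣+∣q∣ []           []           = z≤n
∣p∪q∣≤∣p∣+∣q∣ (true  ∷ p) (b ∷ q)      = s≤s (≤-trans (∣p∪q∣≤∣p∣+∣q∣ p q) (ℕP.+-monoʳ-≤ ∣ p ∣ (∣p∣≤∣x∷p∣ b q)))
∣p∪q∣≤∣p∣+∣q∣ (false ∷ p) (true  ∷ q) = ≤-trans (s≤s (∣p∪q∣≤∣p∣+∣q∣ p q)) (ℕP.≤-reflexive (sym (ℕP.+-suc ∣ p ∣ ∣ q ∣)))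
∣p∪q∣≤∣p∣+∣q∣ (false ∷ p) (false ∷ q) = ∣p∪q∣≤∣p∣+∣q∣ p q

∈⇒lookup : ∀ {n} {p : Subset n} {x} → x ∈ p → T (lookup p x)
∈⇒lookup x∈p = Equivalence.from T-≡ (VecP.[]=⇒lookup x∈p)

lookup⇒∈ : ∀ {n} {p : Subset n} {x} → T (lookup p x) → x ∈ p
lookup⇒∈ {p = p} {x} t = VecP.lookup⇒[]= x p (Equivalence.to T-≡ t)

addAll : ∀ {A : Set} → (A → Maybe ℕ) → List A → Maybe ℕ
addAll F = List.foldr (λ w acc → addM (F w) acc) (just 0)

addAll-just : ∀ {A : Set} (F : A → Maybe ℕ) {n} (g : Fin n → A) (f : Fin n → ℕ) →
  (∀ i → F (g i) ≡ just (f i)) → addAll F (List.tabulate g) ≡ just (sum f)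
addAll-just F {zero}  g f F≡f = refl
addAll-just F {suc n} g f F≡f
  rewrite F≡f zero | addAll-just F (g ∘ suc) (f ∘ suc) (F≡f ∘ suc) = refl

addAll-defined : ∀ {A : Set} (F : A → Maybe ℕ) {n} (g : Fin n → A) {y} →
  addAll F (List.tabulate g) ≡ just y → ∀ i → ∃[ k ] F (g i) ≡ just k
addAll-defined F {suc n} g total≡y i with F (g zero) in F₀≡ | addAll F (List.tabulate (g ∘ suc)) in rest≡
addAll-defined F {suc n} g refl zero    | just k | just _ = k , F₀≡
addAll-defined F {suc n} g refl (suc i) | just _ | just _ = addAll-defined F (g ∘ suc) rest≡ i

-- Edges and bounded-length walks of the network, wrapped in records so
-- that their indices can be inferred.
record Edge {n} (S : Profile n) (u w : Fin n) : Set where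
  constructor edge
  field is-edge : T (adj S u w)

record Reach {n} (S : Profile n) (k : ℕ) (u w : Fin n) : Set where
  constructor reach
  field is-reach : T (within S k u w)

module _ {n : ℕ} {S : Profile n} where

  reach-refl : ∀ u → Reach S 0 u u
  reach-refl u = reach (fromWitness refl)

  reach-zero : ∀ {u w} → Reach S 0 u w → u ≡ w
  reach-zero (reach r) = toWitness r

  reach-suc : ∀ {k u w} → Reach S k u w → Reach S (suc k) u w
  reach-suc (reach r) = reach (Equivalence.from T-∨ (inj₁ r))

  reach-cons : ∀ {k u x w} → Edge S u x → Reach S k x w → Reach S (suc k) u w
  reach-cons {x = x} (edge e) (reach r) =
    reach (Equivalence.from T-∨ (inj₂ (any⁺ _ (lose (∈-allFin x) (Equivalence.from T-∧ (e , r))))))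

  reach-uncons : ∀ {k u w} → Reach S (suc k) u w → Reach S k u w ⊎ ∃[ x ] Edge S u x × Reach S k x w
  reach-uncons (reach r) with Equivalence.to T-∨ r
  ... | inj₁ r′ = inj₁ (reach r′)
  ... | inj₂ r′ with satisfied (any⁻ _ (List.allFin n) r′)
  ... | x , e∧r with Equivalence.to T-∧ e∧r
  ... | e , r″ = inj₂ (x , edge e , reach r″)

  reach-++ : ∀ a {b u x w} → Reach S a u x → Reach S b x w → Reach S (a + b) u w
  reach-++ zero r₁ r₂ with refl ← reach-zero r₁ = r₂
  reach-++ (suc a) r₁ r₂ with reach-uncons r₁
  ... | inj₁ r₁′           = reach-suc (reach-++ a r₁′ r₂)
  ... | inj₂ (y , e , r₁′) = reach-cons e (reach-++ a r₁′ r₂)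

reach-⊆ : ∀ {n} {S S′ : Profile n} → (∀ {u w} → Edge S u w → Edge S′ u w) →
  ∀ {k u w} → Reach S k u w → Reach S′ k u w
reach-⊆ S⊆S′ {zero}  (reach r) = reach r
reach-⊆ S⊆S′ {suc k} r with reach-uncons r
... | inj₁ r′           = reach-suc (reach-⊆ S⊆S′ r′)
... | inj₂ (x , e , r′) = reach-cons (S⊆S′ e) (reach-⊆ S⊆S′ r′)

module _ {n} {S : Profile n} {u w : Fin n} where

  private
    unreachable : ∀ {k} → within S k u w ≡ false → ¬ Reach S k u w
    unreachable eq (reach r) = subst T eq r

    found : ∀ {k} → within S k u w ≡ true →
      Reach S k u w × (∀ i → k ≤ i → i < k → ¬ Reach S i u w)
    found eq = reach (Equivalence.from T-≡ eq) , λ i k≤i i<k → ⊥-elim (ℕP.<⇒≱ i<k k≤i)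

  search-sound : ∀ k fuel {j} → search S u w k fuel ≡ just j →
    Reach S j u w × j ≤ k + fuel × (∀ i → k ≤ i → i < j → ¬ Reach S i u w)
  search-sound k zero h with within S k u w in eq
  search-sound k zero refl | true = proj₁ (found eq) , ℕP.m≤m+n k 0 , proj₂ (found eq)
  search-sound k zero ()   | false
  search-sound k (suc fuel) h with within S k u w in eq
  search-sound k (suc fuel) refl | true = proj₁ (found eq) , ℕP.m≤m+n k (suc fuel) , proj₂ (found eq)
  search-sound k (suc fuel) h | false with search-sound (suc k) fuel h
  ... | r , j≤1+k+fuel , minimal = r , ≤-trans j≤1+k+fuel (ℕP.≤-reflexive (sym (ℕP.+-suc k fuel))) , minimal′
    where
    minimal′ : ∀ i → k ≤ i → i < _ → ¬ Reach S i u w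
    minimal′ i k≤i i<j with ℕP.m≤n⇒m<n∨m≡n k≤i
    ... | inj₁ k<i  = minimal i k<i i<j
    ... | inj₂ refl = unreachable eq

  search-complete : ∀ k fuel {j} → Reach S j u w → k ≤ j → j ≤ k + fuel →
    ∃[ j′ ] search S u w k fuel ≡ just j′
  search-complete k zero r k≤j j≤k+0 with within S k u w in eq
  ... | true  = k , refl
  ... | false with refl ← ℕP.≤-antisym k≤j (≤-trans j≤k+0 (ℕP.≤-reflexive (ℕP.+-identityʳ k)))
    = ⊥-elim (unreachable eq r)
  search-complete k (suc fuel) r k≤j j≤k+1+fuel with within S k u w in eq
  ... | true  = k , refl
  ... | false with ℕP.m≤n⇒m<n∨m≡n k≤j
  ...   | inj₂ refl = ⊥-elim (unreachable eq r)
  ...   | inj₁ k<j  = search-complete (suc k) fuel r k<j (≤-trans j≤k+1+fuel (ℕP.≤-reflexive (ℕP.+-suc k fuel)))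

  dist-reach : ∀ {d} → dist S u w ≡ just d → Reach S d u w
  dist-reach eq = proj₁ (search-sound 0 n eq)

  dist-≤n : ∀ {d} → dist S u w ≡ just d → d ≤ n
  dist-≤n eq = proj₁ (proj₂ (search-sound 0 n eq))

  dist-least : ∀ {d i} → dist S u w ≡ just d → Reach S i u w → d ≤ i
  dist-least {i = i} eq r = ℕP.≮⇒≥ (λ i<d → proj₂ (proj₂ (search-sound 0 n eq)) i z≤n i<d r)

  dist-exists : ∀ {j} → Reach S j u w → j ≤ n → ∃[ d ] dist S u w ≡ just d
  dist-exists r j≤n = search-complete 0 n r z≤n j≤n

dist-self : ∀ {n} (S : Profile n) u → dist S u u ≡ just 0
dist-self S u with dist-exists (reach-refl u) z≤n
... | d , eq with refl ← ℕP.n≤0⇒n≡0 (dist-least eq (reach-refl u)) = eq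

at-dist? : ∀ {n} (S : Profile n) (v : Fin n) (i : ℕ) → Decidable (λ w → dist S v w ≡ just i)
at-dist? S v i w = Maybe.≡-dec ℕ._≟_ (dist S v w) (just i)

module Shortcut {n} (S S′ : Profile n) (v : Fin n)
  (keep : ∀ {u w} → Edge S u w → Edge S′ u w)
  (link : ∀ {x} → dist S v x ≡ just 2 → Edge S′ v x) where

  shortcut : ∀ {w k} → dist S v w ≡ just (2 + k) → Reach S′ (1 + k) v w
  shortcut {w} {k} eq with reach-uncons (dist-reach eq)
  ... | inj₁ r = ⊥-elim (ℕP.1+n≰n (dist-least eq r))
  ... | inj₂ (x₁ , e₁ , r₁) with reach-uncons r₁
  ...   | inj₁ r₁′ = ⊥-elim (ℕP.1+n≰n (dist-least eq (reach-cons e₁ r₁′)))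
  ...   | inj₂ (x₂ , e₂ , r₂) = reach-cons (link x₂-at-2) (reach-⊆ keep r₂)
    where
    -- x₂ is at distance exactly 2: at most 2 via x₁, and at least 2 since
    -- otherwise w would be closer than 2 + k.
    v⇝x₂ : Reach S 2 v x₂
    v⇝x₂ = reach-cons e₁ (reach-cons e₂ (reach-refl x₂))
    x₂-at-2 : dist S v x₂ ≡ just 2
    x₂-at-2 with dist-exists v⇝x₂ (≤-trans (ℕP.m≤m+n 2 k) (dist-≤n eq))
    ... | d₂ , eq₂ = trans eq₂ (cong just (ℕP.≤-antisym (dist-least eq₂ v⇝x₂)
                       (ℕP.+-cancelʳ-≤ k 2 d₂ (dist-least eq (reach-++ d₂ (dist-reach eq₂) r₂)))))

  -- Distances from v do not grow, and every vertex other than v and its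
  -- neighbours gets strictly closer.
  closer : ∀ {w d} → dist S v w ≡ just d →
    ∃[ d′ ] dist S′ v w ≡ just d′ × d′ ≤ d × d′ + 1 ≤ d + (𝟙 (does (w ≟ v)) + 𝟙 (does (at-dist? S v 1 w)))
  closer {w} {d} eq with dist-exists (reach-⊆ keep (dist-reach eq)) (dist-≤n eq)
  ... | d′ , eq′ = d′ , eq′ , d′≤d , bound d eq d′≤d
    where
    d′≤d : d′ ≤ d
    d′≤d = dist-least eq′ (reach-⊆ keep (dist-reach eq))
    bound : ∀ d → dist S v w ≡ just d → d′ ≤ d →
      d′ + 1 ≤ d + (𝟙 (does (w ≟ v)) + 𝟙 (does (at-dist? S v 1 w)))
    bound zero eq₀ d′≤0 with refl ← reach-zero (dist-reach {u = v} {w} eq₀)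
      rewrite dec-true (w ≟ w) refl = ≤-trans (ℕP.+-monoˡ-≤ 1 d′≤0) (ℕP.m≤m+n 1 _)
    bound 1 eq₁ d′≤1 rewrite dec-true (at-dist? S v 1 w) eq₁ =
      ≤-trans (ℕP.+-monoˡ-≤ 1 d′≤1) (ℕP.+-monoʳ-≤ 1 (ℕP.m≤n+m 1 _))
    bound (suc (suc k)) eq₂ _ =
      ≤-trans (ℕP.+-monoˡ-≤ 1 (dist-least eq′ (shortcut eq₂)))
              (≤-trans (ℕP.≤-reflexive (ℕP.+-comm (suc k) 1)) (ℕP.m≤m+n _ _))

  closer-sum : ∀ {y} → distSum S v ≡ just y →
    ∃[ x ] distSum S′ v ≡ just x × x ≤ y × n + x ≤ y + suc (atDist S v 1)
  closer-sum {y} ey = sum d′ , addAll-just (dist S′ v) id d′ (proj₁ ∘ proj₂ ∘ closer-at) ,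
                      subst (sum d′ ≤_) (sym y≡) (sum-mono (proj₁ ∘ proj₂ ∘ proj₂ ∘ closer-at)) , n+x≤y+1+N₁
    where
    defined : ∀ i → ∃[ k ] dist S v i ≡ just k
    defined = addAll-defined (dist S v) id ey
    d : Fin n → ℕ
    d = proj₁ ∘ defined
    y≡ : y ≡ sum d
    y≡ = Maybe.just-injective (trans (sym ey) (addAll-just (dist S v) id d (proj₂ ∘ defined)))
    δ η : Fin n → ℕ
    δ i = 𝟙 (does (i ≟ v))
    η i = 𝟙 (does (at-dist? S v 1 i))
    closer-at : ∀ i → ∃[ d′ ] dist S′ v i ≡ just d′ × d′ ≤ d i × d′ + 1 ≤ d i + (δ i + η i)
    closer-at i = closer (proj₂ (defined i))
    d′ : Fin n → ℕ
    d′ = proj₁ ∘ closer-at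
    n+x≤y+1+N₁ : n + sum d′ ≤ y + suc (atDist S v 1)
    n+x≤y+1+N₁ = begin
      n + sum d′                      ≡⟨ ℕP.+-comm n (sum d′) ⟩
      sum d′ + n                      ≡⟨ cong (_+_ (sum d′)) (sum-ones n) ⟨
      sum d′ + sum {n} (λ _ → 1)      ≡⟨ ∑-distrib-+ d′ (λ _ → 1) ⟨
      sum (λ i → d′ i + 1)            ≤⟨ sum-mono (proj₂ ∘ proj₂ ∘ proj₂ ∘ closer-at) ⟩
      sum (λ i → d i + (δ i + η i))   ≡⟨ ∑-distrib-+ d (λ i → δ i + η i) ⟩
      sum d + sum (λ i → δ i + η i)   ≡⟨ cong₂ _+_ (sym y≡) (∑-distrib-+ δ η) ⟩
      y + (sum δ + sum η)             ≡⟨ cong₂ (λ a b → y + (a + b)) (sum-𝟙-≟ v) (sym (length-filter-sum (at-dist? S v 1) id)) ⟩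
      y + suc (atDist S v 1)          ∎
      where open ≤-Reasoning

deviate-self : ∀ {n} (S : Profile n) v s → deviate S v s v ≡ s
deviate-self S v s with v ≟ v
... | yes _  = refl
... | no v≢v = ⊥-elim (v≢v refl)

deviate-⊇ : ∀ {n} (S : Profile n) v {s} → S v ⊆ s → ∀ u → S u ⊆ deviate S v s u
deviate-⊇ S v {s} Sv⊆s u with u ≟ v
... | yes refl = Sv⊆s
... | no  _    = id

bought⇒Edge : ∀ {n} (S : Profile n) {u w} → w ∈ S u → Edge S u w
bought⇒Edge S w∈Su = edge (Equivalence.from T-∨ (inj₁ (∈⇒lookup w∈Su)))

Edge-⊆ : ∀ {n} {S S′ : Profile n} → (∀ u → S u ⊆ S′ u) → ∀ {u w} → Edge S u w → Edge S′ u w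
Edge-⊆ {S = S} {S′} S⊆S′ {u} {w} (edge e) with Equivalence.to T-∨ e
... | inj₁ w∈Su = edge (Equivalence.from T-∨ (inj₁ (∈⇒lookup (S⊆S′ u (lookup⇒∈ w∈Su)))))
... | inj₂ u∈Sw = edge (Equivalence.from T-∨ (inj₂ (∈⇒lookup (S⊆S′ w (lookup⇒∈ u∈Sw)))))

N₂ : ∀ {n} → Profile n → Fin n → Subset n
N₂ S v = Vec.tabulate (λ x → does (at-dist? S v 2 x))

∈N₂ : ∀ {n} (S : Profile n) v {x} → x ∈ N₂ S v ⇔ dist S v x ≡ just 2
∈N₂ S v {x} = mk⇔
  (λ x∈N₂ → toWitness (subst T (trans (VecP.lookup∘tabulate _ x) (sym (isYes≗does (at-dist? S v 2 x))))
                                  (∈⇒lookup x∈N₂)))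
  (λ at-2 → lookup⇒∈ (subst T (sym (VecP.lookup∘tabulate _ x))
                        (Equivalence.from T-≡ (dec-true (at-dist? S v 2 x) at-2))))

∣N₂∣ : ∀ {n} (S : Profile n) v → ∣ N₂ S v ∣ ≡ atDist S v 2
∣N₂∣ S v = trans (∣tabulate∣ (λ x → does (at-dist? S v 2 x))) (sym (length-filter-sum (at-dist? S v 2) id))

module ShortcutMove {n} (S : Profile n) (valid : ValidProfile S) (v : Fin n) where

  s : Subset n
  s = S v ∪ N₂ S v

  S′ : Profile n
  S′ = deviate S v s

  valid-s : v ∉ s
  valid-s v∈s with x∈p∪q⁻ (S v) (N₂ S v) v∈s
  ... | inj₁ v∈Sv = valid v v∈Sv
  ... | inj₂ v∈N₂ with () ← trans (sym (dist-self S v)) (Equivalence.to (∈N₂ S v) v∈N₂)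

  ∣S′v∣≡∣s∣ : ∣ S′ v ∣ ≡ ∣ s ∣
  ∣S′v∣≡∣s∣ = cong ∣_∣ (deviate-self S v s)

  more-edges : ∣ S v ∣ ≤ ∣ S′ v ∣
  more-edges = ≤-trans (∣p∣≤∣p∪q∣ (S v) (N₂ S v)) (ℕP.≤-reflexive (sym ∣S′v∣≡∣s∣))

  few-more-edges : ∣ S′ v ∣ ≤ ∣ S v ∣ + atDist S v 2
  few-more-edges = begin
    ∣ S′ v ∣              ≡⟨ ∣S′v∣≡∣s∣ ⟩
    ∣ s ∣                 ≤⟨ ∣p∪q∣≤∣p∣+∣q∣ (S v) (N₂ S v) ⟩
    ∣ S v ∣ + ∣ N₂ S v ∣  ≡⟨ cong (_+_ ∣ S v ∣) (∣N₂∣ S v) ⟩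
    ∣ S v ∣ + atDist S v 2 ∎
    where open ≤-Reasoning

  keep : ∀ {u w} → Edge S u w → Edge S′ u w
  keep = Edge-⊆ (deviate-⊇ S v (p⊆p∪q (N₂ S v)))

  link : ∀ {x} → dist S v x ≡ just 2 → Edge S′ v x
  link at-2 = bought⇒Edge S′ (subst (_ ∈_) (sym (deviate-self S v s))
                               (q⊆p∪q (S v) (N₂ S v) (Equivalence.from (∈N₂ S v) at-2)))

  open Shortcut S S′ v keep link public using (closer-sum)

costLt-finite : ∀ {n} α (S′ S : Profile n) v {x y} → distSum S′ v ≡ just x → distSum S v ≡ just y →
  LinLt α (∣ S′ v ∣) x (∣ S v ∣) y → CostLt α S′ S v
costLt-finite α S′ S v ex ey gain rewrite ex | ey = gain

costLt-∞ : ∀ {n} α (S′ S : Profile n) v {x} → distSum S′ v ≡ just x → distSum S v ≡ nothing →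
  CostLt α S′ S v
costLt-∞ α S′ S v ex ey rewrite ex | ey = _

-- At equilibrium every distance sum is finite: otherwise buying an edge to
-- every other vertex would be an improvement.
equilibrium-connected : ∀ α {n} (S : Profile n) → NashEq α S → ∀ v → ∃[ y ] distSum S v ≡ just y
equilibrium-connected α {n} S (_ , stable) v with distSum S v in ey
... | just y  = y , refl
... | nothing = ⊥-elim (stable v others v∉others
                  (costLt-∞ α S* S v (addAll-just (dist S* v) id _ (proj₂ ∘ finite)) ey))
  where
  others : Subset n
  others = ∁ ⁅ v ⁆
  S* : Profile n
  S* = deviate S v others
  v∉others : v ∉ others
  v∉others v∈others = x∈∁p⇒x∉p v∈others (x∈⁅x⁆ v)
  finite : ∀ w → ∃[ d ] dist S* v w ≡ just d
  finite w with w ≟ v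
  ... | yes refl = 0 , dist-self S* v
  ... | no  w≢v  = dist-exists (reach-cons (bought⇒Edge S* w∈S*v) (reach-refl w)) (≤-trans (s≤s z≤n) (toℕ<n v))
    where
    w∈S*v : w ∈ S* v
    w∈S*v = subst (w ∈_) (sym (deviate-self S v others)) (x∉p⇒x∈∁p (w≢v ∘ x∈⁅y⁆⇒x≡y v))

frac-≤ : (a b c d : ℕ) → a * suc d ≤ c * suc b → + a / suc b ℚ.≤ + c / suc d
frac-≤ a b c d h = ℚP.toℚᵘ-cancel-≤
  (ℚᵘP.≤-respˡ-≃ (ℚᵘP.≃-sym (ℚP.toℚᵘ-fromℚᵘ (ℚᵘ.mkℚᵘ (+ a) b)))
  (ℚᵘP.≤-respʳ-≃ (ℚᵘP.≃-sym (ℚP.toℚᵘ-fromℚᵘ (ℚᵘ.mkℚᵘ (+ c) d)))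
    (ℚᵘ.*≤* (subst₂ ℤ._≤_ (ℤP.pos-* a (suc d)) (ℤP.pos-* c (suc b)) (ℤ.+≤+ h)))))

≤-GeQ : ∀ α {p q} → p ℚ.≤ q → RealGeQ α q → RealGeQ α p
≤-GeQ α p≤q q≤α α<p with U-rounded α _ α<p
... | r , r<p , α<r = q≤α (U-upper α r _ (ℚP.<-≤-trans r<p p≤q) α<r)

GeQ-≤1 : ∀ α → RealGt2 α → ∀ {n m} → n ≤ suc m → RealGeQ α (+ n / suc m)
GeQ-≤1 α 2<α {n} {m} n≤1+m = ≤-GeQ α (frac-≤ n m 2 0 n*1≤2*[1+m]) (disjoint α _ 2<α)
  where
  n*1≤2*[1+m] : n * 1 ≤ 2 * suc m
  n*1≤2*[1+m] = ≤-trans (ℕP.≤-reflexive (ℕP.*-identityʳ n))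
                  (≤-trans n≤1+m (ℕP.m≤m+n (suc m) (suc m + 0)))

unprofitable : ∀ α {a b x y} → b ≤ a → ¬ LinLt α a x b y →
  y ≤ x ⊎ ∃[ k ] (suc (b + k) ≡ a × RealGeQ α ((+ y - + x) / suc k))
unprofitable α {a} {b} b≤a ¬gain with compare a b
... | less .a k    = ⊥-elim (ℕP.<⇒≱ (s≤s (ℕP.m≤m+n a k)) b≤a)
... | equal .a     = inj₁ (ℕP.≮⇒≥ ¬gain)
... | greater .b k = inj₂ (k , refl , ¬gain)

mediant : ∀ n t r c m → n ≤ t + r → c + r ≤ m → n * c ≤ t * m ⊎ n ≤ m
mediant n t r c m n≤t+r c+r≤m with c ℕ.≤? t
... | yes c≤t = inj₁ (begin
  n * c           ≤⟨ ℕP.*-monoˡ-≤ c n≤t+r ⟩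
  (t + r) * c     ≡⟨ ℕP.*-distribʳ-+ c t r ⟩
  t * c + r * c   ≤⟨ ℕP.+-monoʳ-≤ (t * c) (ℕP.*-monoʳ-≤ r c≤t) ⟩
  t * c + r * t   ≡⟨ cong (_+_ (t * c)) (ℕP.*-comm r t) ⟩
  t * c + t * r   ≡⟨ ℕP.*-distribˡ-+ t c r ⟨
  t * (c + r)     ≤⟨ ℕP.*-monoʳ-≤ t c+r≤m ⟩
  t * m           ∎)
  where open ≤-Reasoning
... | no c≰t = inj₂ (begin
  n      ≤⟨ n≤t+r ⟩
  t + r  ≤⟨ ℕP.+-monoˡ-≤ r (ℕP.<⇒≤ (ℕP.≰⇒> c≰t)) ⟩
  c + r  ≤⟨ c+r≤m ⟩
  m      ∎)
  where open ≤-Reasoning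

unprofitable-shortcut : ∀ α → RealGt2 α → ∀ {a b x y} n N₁ N₂ →
  b ≤ a → a ≤ b + N₂ → x ≤ y → n + x ≤ y + suc N₁ → ¬ LinLt α a x b y →
  RealGeQ α (+ n / suc (N₁ + N₂))
unprofitable-shortcut α 2<α {a} {b} {x} {y} n N₁ N₂ b≤a a≤b+N₂ x≤y n+x≤y+r ¬gain
  with unprofitable α b≤a ¬gain
... | inj₁ y≤x = GeQ-≤1 α 2<α (ℕP.+-cancelʳ-≤ x n (suc N₁ + N₂) (begin
  n + x              ≤⟨ n+x≤y+r ⟩
  y + suc N₁         ≤⟨ ℕP.+-monoˡ-≤ (suc N₁) y≤x ⟩
  x + suc N₁         ≤⟨ ℕP.+-monoʳ-≤ x (ℕP.m≤m+n (suc N₁) N₂) ⟩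
  x + (suc N₁ + N₂)  ≡⟨ ℕP.+-comm x _ ⟩
  suc N₁ + N₂ + x    ∎))
  where open ≤-Reasoning
... | inj₂ (k , refl , gain/c≤α) =
  [ (λ nc≤tm → ≤-GeQ α (frac-≤ n (N₁ + N₂) (y ∸ x) k nc≤tm) t/c≤α) , GeQ-≤1 α 2<α ]′
    (mediant n (y ∸ x) (suc N₁) (suc k) (suc (N₁ + N₂)) n≤t+r c+r≤m)
  where
  t/c≤α : RealGeQ α (+ (y ∸ x) / suc k)
  t/c≤α = subst (λ g → RealGeQ α (g / suc k)) (trans (ℤP.m-n≡m⊖n y x) (ℤP.⊖-≥ x≤y)) gain/c≤α
  n≤t+r : n ≤ y ∸ x + suc N₁
  n≤t+r = begin
    n                ≡⟨ ℕP.m+n∸n≡m n x ⟨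
    n + x ∸ x        ≤⟨ ℕP.∸-monoˡ-≤ x n+x≤y+r ⟩
    y + suc N₁ ∸ x   ≡⟨ ℕP.+-∸-comm (suc N₁) x≤y ⟩
    y ∸ x + suc N₁   ∎
    where open ≤-Reasoning
  c+r≤m : suc k + suc N₁ ≤ suc (N₁ + N₂)
  c+r≤m = begin
    suc k + suc N₁  ≡⟨ ℕP.+-comm (suc k) (suc N₁) ⟩
    suc N₁ + suc k  ≤⟨ ℕP.+-monoʳ-≤ (suc N₁) 1+k≤N₂ ⟩
    suc N₁ + N₂     ∎
    where
    open ≤-Reasoning
    1+k≤N₂ : suc k ≤ N₂
    1+k≤N₂ = ℕP.+-cancelˡ-≤ b (suc k) N₂ (≤-trans (ℕP.≤-reflexive (ℕP.+-suc b k)) a≤b+N₂)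

lemma3 : (α : Real) → RealGt2 α → NotInteger α →
    (n : ℕ) (S : Profile n) → NashEq α S → (v : Fin n) →
    RealGeQ α ((+ n) / suc (atDist S v 1 + atDist S v 2))
lemma3 α 2<α _ n S (valid , stable) v = bound (equilibrium-connected α S (valid , stable) v)
  where
  open ShortcutMove S valid v
  bound : ∃[ y ] distSum S v ≡ just y → RealGeQ α ((+ n) / suc (atDist S v 1 + atDist S v 2))
  bound (y , ey) with closer-sum ey
  ... | x , ex , x≤y , n+x≤y+1+N₁ =
    unprofitable-shortcut α 2<α n (atDist S v 1) (atDist S v 2) more-edges few-more-edges x≤y n+x≤y+1+N₁
      (λ gain → stable v s valid-s (costLt-finite α S′ S v ex ey gain))
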